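{- Let $k$ be an odd positive integer and $s=(k+1)/2$. For $k$-uniform hypergraphs $\mathcal G$ with $n$ winning sets and maximum degree $o(n)$ (as $n\to\infty$), one has $\mathrm{SC}(\mathcal G,s)=n/2+o(n)$.
   Context: An $s$-of-$k$ game on a $k$-uniform hypergraph $\mathcal G=(V,\mathcal F)$ (finite vertex set $V$, $\mathcal F$ a family of $k$-element subsets of $V$ called winning sets) with integer $1\le s\le k$: Maker and Breaker alternately claim previously unclaimed vertices, Maker first, until all vertices are claimed. The score is the number of winning sets in which Maker has claimed at least $s$ vertices; Maker wants to maximize it, Breaker to minimize it. $\mathrm{SC}(\mathcal G,s)$ is the score when both players play optimally. The maximum degree of $\mathcal G$ is the maximum, over vertices $v$, of the number of winning sets containing $v$. -}

module Defs where

open import Data.Nat using (ℕ; zero; suc; _≤_; _⊔_; _⊓_; _≤ᵇ_)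
open import Data.Bool using (Bool; true; false; _∧_; if_then_else_)
open import Data.Fin using (Fin; _≟_)
open import Data.Fin.Subset using (Subset)
open import Data.Vec using (lookup)
open import Data.List using (List; []; _∷_; length; filter; map; foldr; allFin; filterᵇ)
open import Relation.Nullary using (does)

-- Hypergraph: vertex set Fin v, family of winning sets given as a list of
-- subsets of Fin v (distinctness and k-uniformity are hypotheses in the statement).
Family : ℕ → Set
Family v = List (Subset v)

data Owner : Set where
  free maker breaker : Owner

data Player : Set where
  Maker Breaker : Player

Position : ℕ → Set
Position v = Fin v → Owner

isMaker : Owner → Bool
isMaker maker = true
isMaker _     = false

isFree : Owner → Bool
isFree free = true
isFree _    = false

makerCount : ∀ {v} → Position v → Subset v → ℕ
makerCount {v} p W = length (filterᵇ (λ u → lookup W u ∧ isMaker (p u)) (allFin v))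

score : ∀ {v} → Family v → ℕ → Position v → ℕ
score F s p = length (filterᵇ (λ W → s ≤ᵇ makerCount p W) F)

freeVertices : ∀ {v} → Position v → List (Fin v)
freeVertices {v} p = filterᵇ (λ u → isFree (p u)) (allFin v)

claim : ∀ {v} → Position v → Fin v → Owner → Position v
claim p x o u = if does (u ≟ x) then o else p u

owner : Player → Owner
owner Maker   = maker
owner Breaker = breaker

other : Player → Player
other Maker   = Breaker
other Breaker = Maker

combine : Player → ℕ → ℕ → ℕ
combine Maker   = _⊔_
combine Breaker = _⊓_

opt : Player → ℕ → List ℕ → ℕ
opt pl x xs = foldr (combine pl) x xs

-- minimax value with fuel; fuel = number of vertices suffices since every
-- move claims one free vertex. When no vertex is free the game ends.
value : ∀ {v} → Family v → ℕ → ℕ → Player → Position v → ℕ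
value F s zero    pl p = score F s p
value F s (suc f) pl p with freeVertices p
... | []     = score F s p
... | x ∷ xs = opt pl (next x) (map next xs)
  where
  next : _ → ℕ
  next y = value F s f (other pl) (claim p y (owner pl))

SC : ∀ {v} → Family v → ℕ → ℕ
SC {v} F s = value F s v Maker (λ _ → free)

degree : ∀ {v} → Family v → Fin v → ℕ
degree F u = length (filterᵇ (λ W → lookup W u) F)

maxDegree : ∀ {v} → Family v → ℕ
maxDegree {v} F = foldr _⊔_ 0 (map (degree F) (allFin v))

module Submission where

open import Defs
open import Data.Nat using (ℕ; suc; _+_; _*_; _≤_; ∣_-_∣)
open import Data.Fin.Subset using (Subset; ∣_∣)
open import Data.List using (List; length)
open import Data.List.Relation.Unary.All using (All)
open import Data.List.Relation.Unary.Unique.Propositional using (Unique)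
open import Relation.Binary.PropositionalEquality using (_≡_)
open import Data.Product using (∃-syntax; Σ-syntax; _×_)

open import Data.Nat using (zero; _<_; _⊔_; _⊓_; _≤ᵇ_; _∸_; z≤n; s≤s; s≤s⁻¹)
open import Data.Nat.Properties hiding (_≟_)
open import Data.Bool using (Bool; true; false; not; _∧_; _∨_; T)
open import Data.Bool.Properties using (T-∨)
open import Data.Fin using (Fin; _≟_) renaming (zero to fzero; suc to fsuc)
open import Data.Vec using (_∷_; lookup)
open import Data.List using ([]; _∷_; filterᵇ; map; foldr; tabulate; allFin)
open import Data.List.Properties
  using (foldr-preservesᵒ; length-filter; filter-all; filter-some; length-tabulate; map-cong-local)
open import Data.List.Membership.Propositional using (_∈_)
open import Data.List.Membership.Propositional.Properties
  using (∈-filter⁺; ∈-filter⁻; ∈-map⁺; ∈-map⁻; ∈-allFin; foldr-selective)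
import Data.List.Relation.Unary.All as All
open import Data.List.Relation.Unary.Any as Any using (Any; here; there)
open import Data.Product using (_,_; proj₂)
open import Data.Sum using (_⊎_; inj₁; inj₂; [_,_])
open import Data.Empty using (⊥-elim)
open import Data.Unit using (tt)
open import Function using (_∘_; case_of_; Equivalence)
open import Relation.Nullary using (¬_; yes; no; T?)
open import Relation.Nullary.Reflects using (ofʸ; ofⁿ)
open import Relation.Binary.PropositionalEquality
  using (refl; sym; trans; cong; cong₂; subst; subst₂; _≢_; _≗_; module ≡-Reasoning)

-- Write a and b for the optimal scores from the empty board with Maker, resp. Breaker, moving
-- first, and n for the number of winning sets.  Since k = 2j+1 and s = j+1, on a full board each
-- winning set has at least s vertices of exactly one colour, so exchanging the colours of all
-- vertices exchanges the roles of the players and complements the score: a + b = n.  An extra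
-- Breaker vertex never helps Maker, so moving first is no disadvantage: b ≤ a.  Conversely, if
-- Maker's optimal first vertex y were Breaker's instead, at most deg y winning sets would change
-- status, and the resulting position with Breaker to move is worth at most b: a ≤ b + Δ.
-- Hence |2a - n| = a - b ≤ Δ, which is o(n).

private
  variable
    A : Set

2*j+1≡suc[j+j] : ∀ j → 2 * j + 1 ≡ suc (j + j)
2*j+1≡suc[j+j] j = trans (+-comm (2 * j) 1) (cong (suc ∘ (j +_)) (+-identityʳ j))

majority : ∀ j m n → m + n ≡ 2 * j + 1 → (suc j ≤ᵇ n) ≡ not (suc j ≤ᵇ m)
majority j m n m+n≡ with suc j ≤ᵇ m | ≤ᵇ-reflects-≤ (suc j) m | suc j ≤ᵇ n | ≤ᵇ-reflects-≤ (suc j) n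
... | true  | ofʸ j<m | true  | ofʸ j<n = ⊥-elim (n≮n (suc (j + j))
      (subst₂ _≤_ (cong suc (+-suc j j)) (trans m+n≡ (2*j+1≡suc[j+j] j)) (+-mono-≤ j<m j<n)))
... | true  | ofʸ _   | false | ofⁿ _   = refl
... | false | ofⁿ _   | true  | ofʸ _   = refl
... | false | ofⁿ j≮m | false | ofⁿ j≮n = ⊥-elim (n≮n (j + j)
      (subst (_≤ j + j) (trans m+n≡ (2*j+1≡suc[j+j] j)) (+-mono-≤ (≮⇒≥ j≮m) (≮⇒≥ j≮n))))

∣2m-[m+n]∣≡m∸n : ∀ {m n} → n ≤ m → ∣ 2 * m - (m + n) ∣ ≡ m ∸ n
∣2m-[m+n]∣≡m∸n {m} {n} n≤m = begin
  ∣ m + (m + 0) - m + n ∣  ≡⟨ ∣m+n-m+o∣≡∣n-o∣ m (m + 0) n ⟩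
  ∣ m + 0 - n ∣            ≡⟨ cong ∣_- n ∣ (+-identityʳ m) ⟩
  ∣ m - n ∣                ≡⟨ m≤n⇒∣n-m∣≡n∸m n≤m ⟩
  m ∸ n                    ∎
  where open ≡-Reasoning

count : (A → Bool) → List A → ℕ
count b xs = length (filterᵇ b xs)

filterᵇ-cong : ∀ {b c : A → Bool} xs → (∀ x → b x ≡ c x) → filterᵇ b xs ≡ filterᵇ c xs
filterᵇ-cong []       _   = refl
filterᵇ-cong {b = b} {c} (x ∷ xs) b≗c with b x | c x | b≗c x
... | true  | .true  | refl = cong (x ∷_) (filterᵇ-cong xs b≗c)
... | false | .false | refl = filterᵇ-cong xs b≗c

count-cong : ∀ {b c : A → Bool} xs → (∀ x → b x ≡ c x) → count b xs ≡ count c xs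
count-cong xs b≗c = cong length (filterᵇ-cong xs b≗c)

count-mono : ∀ {b c : A → Bool} xs → (∀ x → T (b x) → T (c x)) → count b xs ≤ count c xs
count-mono []       _   = z≤n
count-mono {b = b} {c} (x ∷ xs) b⇒c with b x | c x | b⇒c x
... | true  | true  | _   = s≤s (count-mono xs b⇒c)
... | true  | false | b⇒c = ⊥-elim (b⇒c tt)
... | false | true  | _   = m≤n⇒m≤1+n (count-mono xs b⇒c)
... | false | false | _   = count-mono xs b⇒c

count-< : ∀ {b c : A → Bool} {xs y} → y ∈ xs → (∀ x → T (c x) → T (b x)) → T (b y) → ¬ T (c y) →
          count c xs < count b xs
count-< {b = b} {c} {x ∷ xs} (here refl) c⇒b by ¬cy with b x | c x
... | true  | false = s≤s (count-mono xs c⇒b)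
... | _     | true  = ⊥-elim (¬cy tt)
count-< {b = b} {c} {x ∷ xs} (there y∈) c⇒b by ¬cy with b x | c x | c⇒b x
... | true  | true  | _   = s≤s (count-< y∈ c⇒b by ¬cy)
... | true  | false | _   = m<n⇒m<1+n (count-< y∈ c⇒b by ¬cy)
... | false | true  | c⇒b = ⊥-elim (c⇒b tt)
... | false | false | _   = count-< y∈ c⇒b by ¬cy

count-∨ : ∀ {b c : A → Bool} xs → count (λ x → b x ∨ c x) xs ≤ count b xs + count c xs
count-∨ []       = z≤n
count-∨ {b = b} {c} (x ∷ xs) with b x | c x
... | true  | true  = s≤s (≤-trans (count-∨ xs) (+-monoʳ-≤ (count b xs) (n≤1+n _)))
... | true  | false = s≤s (count-∨ xs)
... | false | true  = ≤-trans (s≤s (count-∨ xs)) (≤-reflexive (sym (+-suc _ _)))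
... | false | false = count-∨ xs

count-≤-+ : ∀ {b c d : A → Bool} xs → (∀ x → T (b x) → T (c x) ⊎ T (d x)) →
            count b xs ≤ count c xs + count d xs
count-≤-+ {c = c} {d = d} xs b⇒c∨d =
  ≤-trans (count-mono xs (λ x → Equivalence.from T-∨ ∘ b⇒c∨d x)) (count-∨ {b = c} {c = d} xs)

count-partition : ∀ {P : A → Set} (a b c : A → Bool) {xs} → All P xs →
                  (∀ {x} → P x → c x ≡ not (b x)) →
                  count (λ x → a x ∧ b x) xs + count (λ x → a x ∧ c x) xs ≡ count a xs
count-partition a b c         All.[] _ = refl
count-partition a b c {x ∷ xs} (px All.∷ pxs) c≡¬b with a x | b x | c x | c≡¬b px
... | false | _     | _ | _    = count-partition a b c pxs c≡¬b
... | true  | true  | _ | refl = cong suc (count-partition a b c pxs c≡¬b)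
... | true  | false | _ | refl = trans (+-suc _ _) (cong suc (count-partition a b c pxs c≡¬b))

count-true : ∀ (xs : List A) → count (λ _ → true) xs ≡ length xs
count-true xs = cong length (filter-all _ (All.universal (λ _ → tt) xs))

count-tabulate : ∀ {n} {b : A → Bool} (W : Subset n) (f : Fin n → A) →
                 (∀ i → b (f i) ≡ lookup W i) → count b (tabulate f) ≡ ∣ W ∣
count-tabulate Data.Vec.[] f _ = refl
count-tabulate {b = b} (true ∷ W) f bf≡W with b (f fzero) | bf≡W fzero
... | .true | refl = cong suc (count-tabulate W (f ∘ fsuc) (bf≡W ∘ fsuc))
count-tabulate {b = b} (false ∷ W) f bf≡W with b (f fzero) | bf≡W fzero
... | .false | refl = count-tabulate W (f ∘ fsuc) (bf≡W ∘ fsuc)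

∣-∣≡count-lookup : ∀ {n} (W : Subset n) → ∣ W ∣ ≡ count (lookup W) (allFin n)
∣-∣≡count-lookup W = sym (count-tabulate W (λ i → i) (λ _ → refl))

foldr-⊔-upper : ∀ {k} e ys → k ≤ e ⊎ Any (k ≤_) ys → k ≤ foldr _⊔_ e ys
foldr-⊔-upper = foldr-preservesᵒ (λ x y → [ m≤n⇒m≤n⊔o y , m≤n⇒m≤o⊔n x ])

foldr-⊓-lower : ∀ {k} e ys → e ≤ k ⊎ Any (_≤ k) ys → foldr _⊓_ e ys ≤ k
foldr-⊓-lower = foldr-preservesᵒ (λ x y → [ m≤n⇒m⊓o≤n y , m≤n⇒o⊓m≤n x ])

∈⇒≤foldr-⊔ : ∀ {k} e {ys} → k ∈ ys → k ≤ foldr _⊔_ e ys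
∈⇒≤foldr-⊔ e k∈ = foldr-⊔-upper e _ (inj₂ (Any.map ≤-reflexive k∈))

∈⇒foldr-⊓≤ : ∀ {k} e {ys} → k ∈ ys → foldr _⊓_ e ys ≤ k
∈⇒foldr-⊓≤ e k∈ = foldr-⊓-lower e _ (inj₂ (Any.map (≤-reflexive ∘ sym) k∈))

opt-Maker-upper : ∀ (g : A → ℕ) x xs {z} → z ∈ x ∷ xs → g z ≤ opt Maker (g x) (map g xs)
opt-Maker-upper g x xs (here refl) = foldr-⊔-upper (g x) (map g xs) (inj₁ ≤-refl)
opt-Maker-upper g x xs (there z∈)  = ∈⇒≤foldr-⊔ (g x) (∈-map⁺ g z∈)

opt-Breaker-lower : ∀ (g : A → ℕ) x xs {z} → z ∈ x ∷ xs → opt Breaker (g x) (map g xs) ≤ g z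
opt-Breaker-lower g x xs (here refl) = foldr-⊓-lower (g x) (map g xs) (inj₁ ≤-refl)
opt-Breaker-lower g x xs (there z∈)  = ∈⇒foldr-⊓≤ (g x) (∈-map⁺ g z∈)

combine-selective : ∀ pl m n → combine pl m n ≡ m ⊎ combine pl m n ≡ n
combine-selective Maker   = ⊔-sel
combine-selective Breaker = ⊓-sel

opt-attained : ∀ pl (g : A → ℕ) x xs → ∃[ z ] z ∈ x ∷ xs × opt pl (g x) (map g xs) ≡ g z
opt-attained pl g x xs with foldr-selective (combine-selective pl) (g x) (map g xs)
... | inj₁ opt≡gx = x , here refl , opt≡gx
... | inj₂ opt∈   with ∈-map⁻ g opt∈
...   | z , z∈ , opt≡gz = z , there z∈ , opt≡gz

owner≢free : ∀ pl → owner pl ≢ free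
owner≢free Maker   ()
owner≢free Breaker ()

isFree⇒≡free : ∀ {o} → T (isFree o) → o ≡ free
isFree⇒≡free {free} _ = refl

≡free⇒isFree : ∀ {o} → o ≡ free → T (isFree o)
≡free⇒isFree refl = tt

module _ {v : ℕ} where

  Full : Position v → Set
  Full p = ∀ u → p u ≢ free

  #free : Position v → ℕ
  #free p = length (freeVertices p)

  _⊑_ : Position v → Position v → Set
  p ⊑ q = ∀ u → T (isMaker (p u)) → T (isMaker (q u))

  ∈-freeVertices⁺ : ∀ {p : Position v} {u} → p u ≡ free → u ∈ freeVertices p
  ∈-freeVertices⁺ pu≡free = ∈-filter⁺ (T? ∘ isFree ∘ _) (∈-allFin _) (≡free⇒isFree pu≡free)

  ∈-freeVertices⁻ : ∀ {p : Position v} {u} → u ∈ freeVertices p → p u ≡ free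
  ∈-freeVertices⁻ {p} u∈ = isFree⇒≡free (proj₂ (∈-filter⁻ (T? ∘ isFree ∘ p) {xs = allFin v} u∈))

  freeVertices-cong : ∀ {p q : Position v} → p ≗ q → freeVertices p ≡ freeVertices q
  freeVertices-cong p≗q = filterᵇ-cong (allFin v) (cong isFree ∘ p≗q)

  full-or-free : (p : Position v) → Full p ⊎ ∃[ y ] p y ≡ free
  full-or-free p with freeVertices p in eq
  ... | []    = inj₁ (λ u pu≡free → case subst (u ∈_) eq (∈-freeVertices⁺ pu≡free) of λ ())
  ... | y ∷ _ = inj₂ (y , ∈-freeVertices⁻ (subst (y ∈_) (sym eq) (here refl)))

  #free≤0⇒Full : ∀ {p : Position v} → #free p ≤ 0 → Full p
  #free≤0⇒Full {p} #free≤0 u pu≡free = n≮n 0 (≤-trans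
    (filter-some (T? ∘ isFree ∘ p) (Any.map (λ { refl → ≡free⇒isFree pu≡free }) (∈-allFin u)))
    #free≤0)

  #free≤v : (p : Position v) → #free p ≤ v
  #free≤v p = ≤-trans (length-filter (T? ∘ isFree ∘ p) (allFin v)) (≤-reflexive (length-tabulate (λ i → i)))

  claim-≡ : ∀ (p : Position v) x o → claim p x o x ≡ o
  claim-≡ p x o with x ≟ x
  ... | yes _   = refl
  ... | no x≢x  = ⊥-elim (x≢x refl)

  claim-≢ : ∀ (p : Position v) {x} o {u} → u ≢ x → claim p x o u ≡ p u
  claim-≢ p {x} o {u} u≢x with u ≟ x
  ... | yes u≡x = ⊥-elim (u≢x u≡x)
  ... | no _    = refl

  claim-cong : ∀ {p q : Position v} → p ≗ q → ∀ x o → claim p x o ≗ claim q x o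
  claim-cong p≗q x o u with u ≟ x
  ... | yes _ = refl
  ... | no _  = p≗q u

  claim-comm : ∀ (p : Position v) {x y} a b → x ≢ y → claim (claim p x a) y b ≗ claim (claim p y b) x a
  claim-comm p {x} {y} a b x≢y u with u ≟ x | u ≟ y
  ... | yes refl | yes refl = ⊥-elim (x≢y refl)
  ... | yes _    | no _     = refl
  ... | no _     | yes _    = refl
  ... | no _     | no _     = refl

  free-claim : ∀ (p : Position v) {x y} o → y ≢ x → p y ≡ free → claim p x o y ≡ free
  free-claim p o y≢x py≡free = trans (claim-≢ p o y≢x) py≡free

  claim-free⁻ : ∀ (p : Position v) {x o y} → o ≢ free → claim p x o y ≡ free → y ≢ x × p y ≡ free
  claim-free⁻ p {x} {o} {y} o≢free claimed≡free with y ≟ x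
  ... | yes refl = ⊥-elim (o≢free claimed≡free)
  ... | no y≢x   = y≢x , claimed≡free

  Full-claim : ∀ (p : Position v) {x o o'} → Full (claim p x o) → o' ≢ free → Full (claim p x o')
  Full-claim p {o = o} full o'≢free y claimed≡free with claim-free⁻ p o'≢free claimed≡free
  ... | y≢x , py≡free = full y (free-claim p o y≢x py≡free)

  #free-claim : ∀ (p : Position v) {y o} → p y ≡ free → o ≢ free → #free (claim p y o) < #free p
  #free-claim p {y} {o} py≡free o≢free =
    count-< (∈-allFin y) still-free (≡free⇒isFree py≡free) claimed
    where
    still-free : ∀ u → T (isFree (claim p y o u)) → T (isFree (p u))
    still-free u = ≡free⇒isFree ∘ proj₂ ∘ claim-free⁻ p o≢free ∘ isFree⇒≡free
    claimed : ¬ T (isFree (claim p y o y))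
    claimed = o≢free ∘ trans (sym (claim-≡ p y o)) ∘ isFree⇒≡free

  #free-claim≤ : ∀ {f} (p : Position v) {y o} → p y ≡ free → o ≢ free → #free p ≤ suc f →
                 #free (claim p y o) ≤ f
  #free-claim≤ p py≡free o≢free #free≤ = s≤s⁻¹ (≤-trans (#free-claim p py≡free o≢free) #free≤)

  claim-breaker-⊑ : ∀ (p : Position v) x → claim p x breaker ⊑ p
  claim-breaker-⊑ p x u with u ≟ x
  ... | yes _ = λ ()
  ... | no _  = λ pu → pu

  claim-breaker⊑claim-maker : ∀ (p : Position v) x → claim p x breaker ⊑ claim p x maker
  claim-breaker⊑claim-maker p x u with u ≟ x
  ... | yes _ = λ ()
  ... | no _  = λ pu → pu

-- Exchanging the colours

swapOwner : Owner → Owner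
swapOwner free    = free
swapOwner maker   = breaker
swapOwner breaker = maker

swapOwner-involutive : ∀ o → swapOwner (swapOwner o) ≡ o
swapOwner-involutive free    = refl
swapOwner-involutive maker   = refl
swapOwner-involutive breaker = refl

swapOwner-free⁻ : ∀ {o} → swapOwner o ≡ free → o ≡ free
swapOwner-free⁻ {free} _ = refl

isFree-swapOwner : ∀ o → isFree (swapOwner o) ≡ isFree o
isFree-swapOwner free    = refl
isFree-swapOwner maker   = refl
isFree-swapOwner breaker = refl

isMaker-swapOwner : ∀ {o} → o ≢ free → isMaker (swapOwner o) ≡ not (isMaker o)
isMaker-swapOwner {free}    o≢free = ⊥-elim (o≢free refl)
isMaker-swapOwner {maker}   _      = refl
isMaker-swapOwner {breaker} _      = refl

module _ {v : ℕ} where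

  swap : Position v → Position v
  swap p = swapOwner ∘ p

  swap-involutive : ∀ (p : Position v) → swap (swap p) ≗ p
  swap-involutive p = swapOwner-involutive ∘ p

  swap-claim : ∀ (p : Position v) y o → swap (claim p y o) ≗ claim (swap p) y (swapOwner o)
  swap-claim p y o u with u ≟ y
  ... | yes _ = refl
  ... | no _  = refl

  swap-Full : ∀ {p : Position v} → Full p → Full (swap p)
  swap-Full full u = full u ∘ swapOwner-free⁻

  #free-swap : ∀ (p : Position v) → #free (swap p) ≡ #free p
  #free-swap p = count-cong (allFin v) (isFree-swapOwner ∘ p)

-- Game values for an arbitrary threshold s

module Game {v : ℕ} (F : Family v) (s : ℕ) where

  open ≤-Reasoning

  val : ℕ → Player → Position v → ℕ
  val = value F s

  degree≤maxDegree : ∀ u → degree F u ≤ maxDegree F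
  degree≤maxDegree u = ∈⇒≤foldr-⊔ 0 (∈-map⁺ (degree F) (∈-allFin u))

  score-cong : ∀ {p q : Position v} → p ≗ q → score F s p ≡ score F s q
  score-cong p≗q = count-cong F λ W →
    cong (s ≤ᵇ_) (count-cong (allFin v) (λ u → cong (λ o → lookup W u ∧ isMaker o) (p≗q u)))

  score-mono : ∀ {p q : Position v} → p ⊑ q → score F s p ≤ score F s q
  score-mono {p} {q} p⊑q = count-mono F λ W s≤p →
    ≤⇒≤ᵇ (≤-trans (≤ᵇ⇒≤ s (makerCount p W) s≤p) (count-mono (allFin v) (∧-monoʳ W)))
    where
    ∧-monoʳ : ∀ W u → T (lookup W u ∧ isMaker (p u)) → T (lookup W u ∧ isMaker (q u))
    ∧-monoʳ W u with lookup W u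
    ... | true  = p⊑q u
    ... | false = λ ()

  score-claim-maker≤ : ∀ (p : Position v) x →
    score F s (claim p x maker) ≤ score F s (claim p x breaker) + degree F x
  score-claim-maker≤ p x = count-≤-+ F winning
    where
    same-outside : ∀ W → lookup W x ≡ false →
      makerCount (claim p x maker) W ≡ makerCount (claim p x breaker) W
    same-outside W x∉W = count-cong (allFin v) agree
      where
      agree : ∀ u → (lookup W u ∧ isMaker (claim p x maker u)) ≡
                    (lookup W u ∧ isMaker (claim p x breaker u))
      agree u with u ≟ x
      ... | yes refl rewrite x∉W = refl
      ... | no _                 = refl
    winning : ∀ W → T (s ≤ᵇ makerCount (claim p x maker) W) →
              T (s ≤ᵇ makerCount (claim p x breaker) W) ⊎ T (lookup W x)
    winning W with lookup W x in x∈W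
    ... | true  = λ _ → inj₂ tt
    ... | false = inj₁ ∘ subst (λ m → T (s ≤ᵇ m)) (same-outside W x∈W)

  value-cong : ∀ f pl {p q : Position v} → p ≗ q → val f pl p ≡ val f pl q
  value-cong zero    pl         p≗q = score-cong p≗q
  value-cong (suc f) pl {p} {q} p≗q with freeVertices p | freeVertices q | freeVertices-cong p≗q
  ... | []     | .[]       | refl = score-cong p≗q
  ... | x ∷ xs | .(x ∷ xs) | refl = cong₂ (opt pl) (next x) (map-cong-local (All.universal next xs))
    where
    next : ∀ y → val f (other pl) (claim p y (owner pl)) ≡ val f (other pl) (claim q y (owner pl))
    next y = value-cong f (other pl) (claim-cong p≗q y (owner pl))

  value-claim-comm : ∀ f pl (p : Position v) {x y} a b → x ≢ y →
                     val f pl (claim (claim p x a) y b) ≡ val f pl (claim (claim p y b) x a)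
  value-claim-comm f pl p a b x≢y = value-cong f pl (claim-comm p a b x≢y)

  value-Full : ∀ f pl {p : Position v} → Full p → val f pl p ≡ score F s p
  value-Full zero    pl     _    = refl
  value-Full (suc f) pl {p} full with freeVertices p in eq
  ... | []    = refl
  ... | x ∷ _ = ⊥-elim (full x (∈-freeVertices⁻ (subst (x ∈_) (sym eq) (here refl))))

  value-optimal-move : ∀ f pl {p : Position v} {y} → p y ≡ free →
    ∃[ z ] p z ≡ free × val (suc f) pl p ≡ val f (other pl) (claim p z (owner pl))
  value-optimal-move f pl {p} py≡free with freeVertices p in eq | ∈-freeVertices⁺ {p = p} py≡free
  ... | x ∷ xs | _ with opt-attained pl (λ z → val f (other pl) (claim p z (owner pl))) x xs
  ...   | z , z∈ , opt≡ = z , ∈-freeVertices⁻ (subst (z ∈_) (sym eq) z∈) , opt≡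

  data Step (f : ℕ) (pl : Player) (p : Position v) : Set where
    game-over : Full p → val (suc f) pl p ≡ score F s p → Step f pl p
    best-move : ∀ y → p y ≡ free → val (suc f) pl p ≡ val f (other pl) (claim p y (owner pl)) →
                Step f pl p

  step : ∀ f pl (p : Position v) → Step f pl p
  step f pl p with full-or-free p
  ... | inj₁ full          = game-over full (value-Full (suc f) pl full)
  ... | inj₂ (_ , py≡free) with value-optimal-move f pl py≡free
  ...   | z , pz≡free , val≡ = best-move z pz≡free val≡

  move≤value-Maker : ∀ f {p : Position v} {y} → p y ≡ free →
                     val f Breaker (claim p y maker) ≤ val (suc f) Maker p
  move≤value-Maker f {p} py≡free with freeVertices p | ∈-freeVertices⁺ {p = p} py≡free
  ... | x ∷ xs | y∈ = opt-Maker-upper (λ z → val f Breaker (claim p z maker)) x xs y∈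

  value-Breaker≤move : ∀ f {p : Position v} {y} → p y ≡ free →
                       val (suc f) Breaker p ≤ val f Maker (claim p y breaker)
  value-Breaker≤move f {p} py≡free with freeVertices p | ∈-freeVertices⁺ {p = p} py≡free
  ... | x ∷ xs | y∈ = opt-Breaker-lower (λ z → val f Maker (claim p z breaker)) x xs y∈

  value-suc-cong : ∀ {f f'} pl (p : Position v) →
    (∀ {y} → p y ≡ free →
       val f (other pl) (claim p y (owner pl)) ≡ val f' (other pl) (claim p y (owner pl))) →
    val (suc f) pl p ≡ val (suc f') pl p
  value-suc-cong pl p next≡ with freeVertices p in eq
  ... | []     = refl
  ... | x ∷ xs = cong₂ (opt pl) (next≡ (is-free (here refl)))
                               (map-cong-local (All.tabulate (next≡ ∘ is-free ∘ there)))
    where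
    is-free : ∀ {y} → y ∈ x ∷ xs → p y ≡ free
    is-free y∈ = ∈-freeVertices⁻ (subst (_ ∈_) (sym eq) y∈)

  -- With less fuel than free vertices, value stops early at the current score; the hypotheses
  -- #free p ≤ f below rule this out.
  value-suc-fuel : ∀ f pl {p : Position v} → #free p ≤ f → val (suc f) pl p ≡ val f pl p
  value-suc-fuel zero    pl     #free≤0 = value-Full 1 pl (#free≤0⇒Full #free≤0)
  value-suc-fuel (suc f) pl {p} #free≤  = value-suc-cong pl p λ py≡free →
    value-suc-fuel f (other pl) (#free-claim≤ p py≡free (owner≢free pl) #free≤)

  value-claim-maker≤ : ∀ f pl (p : Position v) x →
    val f pl (claim p x maker) ≤ val f pl (claim p x breaker) + degree F x
  value-claim-maker≤ zero pl p x = score-claim-maker≤ p x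
  value-claim-maker≤ (suc f) Maker p x with step f Maker (claim p x maker)
  ... | game-over full val≡ = begin
    val (suc f) Maker (claim p x maker)
      ≡⟨ val≡ ⟩
    score F s (claim p x maker)
      ≤⟨ score-claim-maker≤ p x ⟩
    score F s (claim p x breaker) + degree F x
      ≡⟨ cong (_+ degree F x) (value-Full (suc f) Maker (Full-claim p full λ ())) ⟨
    val (suc f) Maker (claim p x breaker) + degree F x ∎
  ... | best-move y free-y val≡ with claim-free⁻ p (λ ()) free-y
  ...   | y≢x , py≡free = begin
    val (suc f) Maker (claim p x maker)
      ≡⟨ val≡ ⟩
    val f Breaker (claim (claim p x maker) y maker)
      ≡⟨ value-claim-comm f Breaker p maker maker (y≢x ∘ sym) ⟩
    val f Breaker (claim (claim p y maker) x maker)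
      ≤⟨ value-claim-maker≤ f Breaker (claim p y maker) x ⟩
    val f Breaker (claim (claim p y maker) x breaker) + degree F x
      ≡⟨ cong (_+ degree F x) (value-claim-comm f Breaker p maker breaker y≢x) ⟩
    val f Breaker (claim (claim p x breaker) y maker) + degree F x
      ≤⟨ +-monoˡ-≤ (degree F x) (move≤value-Maker f (free-claim p breaker y≢x py≡free)) ⟩
    val (suc f) Maker (claim p x breaker) + degree F x ∎
  value-claim-maker≤ (suc f) Breaker p x with step f Breaker (claim p x breaker)
  ... | game-over full val≡ = begin
    val (suc f) Breaker (claim p x maker)
      ≡⟨ value-Full (suc f) Breaker (Full-claim p full λ ()) ⟩
    score F s (claim p x maker)
      ≤⟨ score-claim-maker≤ p x ⟩
    score F s (claim p x breaker) + degree F x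
      ≡⟨ cong (_+ degree F x) val≡ ⟨
    val (suc f) Breaker (claim p x breaker) + degree F x ∎
  ... | best-move y free-y val≡ with claim-free⁻ p (λ ()) free-y
  ...   | y≢x , py≡free = begin
    val (suc f) Breaker (claim p x maker)
      ≤⟨ value-Breaker≤move f (free-claim p maker y≢x py≡free) ⟩
    val f Maker (claim (claim p x maker) y breaker)
      ≡⟨ value-claim-comm f Maker p maker breaker (y≢x ∘ sym) ⟩
    val f Maker (claim (claim p y breaker) x maker)
      ≤⟨ value-claim-maker≤ f Maker (claim p y breaker) x ⟩
    val f Maker (claim (claim p y breaker) x breaker) + degree F x
      ≡⟨ cong (_+ degree F x) (value-claim-comm f Maker p breaker breaker y≢x) ⟩
    val f Maker (claim (claim p x breaker) y breaker) + degree F x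
      ≡⟨ cong (_+ degree F x) val≡ ⟨
    val (suc f) Breaker (claim p x breaker) + degree F x ∎

  BreakerClaim≤ : ℕ → Player → Set
  BreakerClaim≤ f pl = ∀ {p : Position v} {x} → p x ≡ free → #free p ≤ f →
                       val f pl (claim p x breaker) ≤ val f pl p

  -- Kept apart from value-claim-breaker≤ so that value-Breaker≤value-Maker can use it at fuel
  -- suc f while the mutual recursion stays structurally decreasing.
  breakerClaim≤-Maker : ∀ f → BreakerClaim≤ f Breaker → BreakerClaim≤ (suc f) Maker
  breakerClaim≤-Maker f ih {p} {x} px≡free #free≤ with step f Maker (claim p x breaker)
  ... | game-over full val≡ = begin
    val (suc f) Maker (claim p x breaker)  ≡⟨ val≡ ⟩
    score F s (claim p x breaker)          ≤⟨ score-mono (claim-breaker⊑claim-maker p x) ⟩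
    score F s (claim p x maker)            ≡⟨ value-Full f Breaker (Full-claim p full λ ()) ⟨
    val f Breaker (claim p x maker)        ≤⟨ move≤value-Maker f px≡free ⟩
    val (suc f) Maker p                    ∎
  ... | best-move y free-y val≡ with claim-free⁻ p (λ ()) free-y
  ...   | y≢x , py≡free = begin
    val (suc f) Maker (claim p x breaker)
      ≡⟨ val≡ ⟩
    val f Breaker (claim (claim p x breaker) y maker)
      ≡⟨ value-claim-comm f Breaker p breaker maker (y≢x ∘ sym) ⟩
    val f Breaker (claim (claim p y maker) x breaker)
      ≤⟨ ih (free-claim p maker (y≢x ∘ sym) px≡free) (#free-claim≤ p py≡free (λ ()) #free≤) ⟩
    val f Breaker (claim p y maker)
      ≤⟨ move≤value-Maker f py≡free ⟩
    val (suc f) Maker p ∎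

  value-claim-breaker≤ : ∀ f pl → BreakerClaim≤ f pl
  value-Breaker≤value-Maker : ∀ f {p : Position v} → #free p ≤ f → val f Breaker p ≤ val f Maker p

  value-claim-breaker≤ zero    pl {p} {x} _ _ = score-mono (claim-breaker-⊑ p x)
  value-claim-breaker≤ (suc f) Maker = breakerClaim≤-Maker f (value-claim-breaker≤ f Breaker)
  value-claim-breaker≤ (suc f) Breaker {p} {x} px≡free #free≤ with step f Breaker p
  ... | game-over full _ = ⊥-elim (full x px≡free)
  ... | best-move y py≡free val≡ with y ≟ x
  -- Breaker's best move is x itself: claim p x breaker is then the position after it, but with
  -- Breaker to move again.
  ...   | yes refl = begin
    val (suc f) Breaker (claim p y breaker)  ≡⟨ value-suc-fuel f Breaker fewer ⟩
    val f Breaker (claim p y breaker)        ≤⟨ value-Breaker≤value-Maker f fewer ⟩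
    val f Maker (claim p y breaker)          ≡⟨ val≡ ⟨
    val (suc f) Breaker p                    ∎
    where fewer = #free-claim≤ p py≡free (λ ()) #free≤
  ...   | no y≢x = begin
    val (suc f) Breaker (claim p x breaker)
      ≤⟨ value-Breaker≤move f (free-claim p breaker y≢x py≡free) ⟩
    val f Maker (claim (claim p x breaker) y breaker)
      ≡⟨ value-claim-comm f Maker p breaker breaker (y≢x ∘ sym) ⟩
    val f Maker (claim (claim p y breaker) x breaker)
      ≤⟨ value-claim-breaker≤ f Maker (free-claim p breaker (y≢x ∘ sym) px≡free)
                                      (#free-claim≤ p py≡free (λ ()) #free≤) ⟩
    val f Maker (claim p y breaker)
      ≡⟨ val≡ ⟨
    val (suc f) Breaker p ∎

  value-Breaker≤value-Maker zero    _ = ≤-refl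
  value-Breaker≤value-Maker (suc f) {p} #free≤ with full-or-free p
  ... | inj₁ full =
    ≤-reflexive (trans (value-Full (suc f) Breaker full) (sym (value-Full (suc f) Maker full)))
  ... | inj₂ (y , py≡free) = begin
    val (suc f) Breaker p
      ≤⟨ value-Breaker≤move f py≡free ⟩
    val f Maker (claim p y breaker)
      ≡⟨ value-suc-fuel f Maker (#free-claim≤ p py≡free (λ ()) #free≤) ⟨
    val (suc f) Maker (claim p y breaker)
      ≤⟨ breakerClaim≤-Maker f (value-claim-breaker≤ f Breaker) py≡free #free≤ ⟩
    val (suc f) Maker p ∎

  value-Maker≤value-Breaker+maxDegree : ∀ f {p : Position v} → #free p ≤ f →
                                        val f Maker p ≤ val f Breaker p + maxDegree F
  value-Maker≤value-Breaker+maxDegree zero    _ = m≤m+n _ _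
  value-Maker≤value-Breaker+maxDegree (suc f) {p} #free≤ with step f Maker p
  ... | game-over full val≡ =
    ≤-trans (≤-reflexive (trans val≡ (sym (value-Full (suc f) Breaker full)))) (m≤m+n _ _)
  ... | best-move y py≡free val≡ = begin
    val (suc f) Maker p
      ≡⟨ val≡ ⟩
    val f Breaker (claim p y maker)
      ≤⟨ value-claim-maker≤ f Breaker p y ⟩
    val f Breaker (claim p y breaker) + degree F y
      ≡⟨ cong (_+ degree F y) (value-suc-fuel f Breaker (#free-claim≤ p py≡free (λ ()) #free≤)) ⟨
    val (suc f) Breaker (claim p y breaker) + degree F y
      ≤⟨ +-mono-≤ (value-claim-breaker≤ (suc f) Breaker py≡free #free≤) (degree≤maxDegree y) ⟩
    val (suc f) Breaker p + maxDegree F ∎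

-- Odd uniformity with the majority threshold

module Majority {v : ℕ} (F : Family v) (j : ℕ) (uniform : All (λ W → ∣ W ∣ ≡ 2 * j + 1) F) where

  open Game F (suc j)
  open ≤-Reasoning

  makerCount-swap : ∀ {p : Position v} → Full p → ∀ W → makerCount p W + makerCount (swap p) W ≡ ∣ W ∣
  makerCount-swap {p} full W = trans
    (count-partition (lookup W) (isMaker ∘ p) (isMaker ∘ swap p) (All.universal full (allFin v))
                     (λ {u} → isMaker-swapOwner {p u}))
    (sym (∣-∣≡count-lookup W))

  score-swap : ∀ {p : Position v} → Full p → score F (suc j) p + score F (suc j) (swap p) ≡ length F
  score-swap {p} full = trans
    (count-partition (λ _ → true) (λ W → suc j ≤ᵇ makerCount p W) (λ W → suc j ≤ᵇ makerCount (swap p) W)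
                     uniform (λ {W} ∣W∣≡ → majority j (makerCount p W) (makerCount (swap p) W)
                                                     (trans (makerCount-swap full W) ∣W∣≡)))
    (count-true F)

  value-swap : ∀ f {p : Position v} → #free p ≤ f → val f Maker p + val f Breaker (swap p) ≡ length F
  value-swap zero    #free≤0 = score-swap (#free≤0⇒Full #free≤0)
  value-swap (suc f) {p} #free≤ with step f Maker p
  ... | game-over full val≡ =
    trans (cong₂ _+_ val≡ (value-Full (suc f) Breaker (swap-Full full))) (score-swap full)
  ... | best-move y py≡free val≡ = ≤-antisym upper lower
    where
    mirror : ∀ {q} → #free q ≤ f → val f Breaker q + val f Maker (swap q) ≡ length F
    mirror {q} #free≤ = begin-equality
      val f Breaker q + val f Maker (swap q)
        ≡⟨ +-comm (val f Breaker q) _ ⟩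
      val f Maker (swap q) + val f Breaker q
        ≡⟨ cong (val f Maker (swap q) +_) (value-cong f Breaker (swap-involutive q)) ⟨
      val f Maker (swap q) + val f Breaker (swap (swap q))
        ≡⟨ value-swap f (subst (_≤ f) (sym (#free-swap q)) #free≤) ⟩
      length F ∎
    upper : val (suc f) Maker p + val (suc f) Breaker (swap p) ≤ length F
    upper = begin
      val (suc f) Maker p + val (suc f) Breaker (swap p)
        ≤⟨ +-mono-≤ (≤-reflexive val≡) (value-Breaker≤move f (cong swapOwner py≡free)) ⟩
      val f Breaker (claim p y maker) + val f Maker (claim (swap p) y breaker)
        ≡⟨ cong (val f Breaker (claim p y maker) +_) (value-cong f Maker (swap-claim p y maker)) ⟨
      val f Breaker (claim p y maker) + val f Maker (swap (claim p y maker))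
        ≡⟨ mirror (#free-claim≤ p py≡free (λ ()) #free≤) ⟩
      length F ∎
    lower : length F ≤ val (suc f) Maker p + val (suc f) Breaker (swap p)
    lower with step f Breaker (swap p)
    ... | game-over full _ = ⊥-elim (full y (cong swapOwner py≡free))
    ... | best-move z sz≡free val'≡ = begin
      length F
        ≡⟨ mirror (#free-claim≤ p pz≡free (λ ()) #free≤) ⟨
      val f Breaker (claim p z maker) + val f Maker (swap (claim p z maker))
        ≡⟨ cong (val f Breaker (claim p z maker) +_) (value-cong f Maker (swap-claim p z maker)) ⟩
      val f Breaker (claim p z maker) + val f Maker (claim (swap p) z breaker)
        ≤⟨ +-mono-≤ (move≤value-Maker f pz≡free) (≤-reflexive (sym val'≡)) ⟩
      val (suc f) Maker p + val (suc f) Breaker (swap p) ∎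
      where pz≡free = swapOwner-free⁻ sz≡free

  ∣2*SC-length∣≤maxDegree : ∣ 2 * SC F (suc j) - length F ∣ ≤ maxDegree F
  ∣2*SC-length∣≤maxDegree = begin
    ∣ 2 * a - length F ∣  ≡⟨ cong ∣ 2 * a -_∣ a+b≡n ⟨
    ∣ 2 * a - (a + b) ∣   ≡⟨ ∣2m-[m+n]∣≡m∸n (value-Breaker≤value-Maker v enough-fuel) ⟩
    a ∸ b                 ≤⟨ m≤n+o⇒m∸n≤o a b (value-Maker≤value-Breaker+maxDegree v enough-fuel) ⟩
    maxDegree F           ∎
    where
    empty : Position v
    empty _ = free
    enough-fuel : #free empty ≤ v
    enough-fuel = #free≤v empty
    a = val v Maker empty
    b = val v Breaker empty
    a+b≡n : a + b ≡ length F
    a+b≡n = trans (cong (a +_) (value-cong v Breaker λ _ → refl)) (value-swap v enough-fuel)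

lemma5 : (j m : ℕ) → 1 ≤ m →
    ∃[ d ] ∃[ N ] ((v : ℕ) (F : Family v) → Unique F →
      All (λ W → ∣ W ∣ ≡ 2 * j + 1) F →
      N ≤ length F → maxDegree F * d ≤ length F →
      m * ∣ 2 * SC F (suc j) - length F ∣ ≤ 2 * length F)
lemma5 j m _ = m , 0 , λ v F _ uniform _ Δ*m≤n → begin
  m * ∣ 2 * SC F (suc j) - length F ∣  ≤⟨ *-monoʳ-≤ m (Majority.∣2*SC-length∣≤maxDegree F j uniform) ⟩
  m * maxDegree F                      ≡⟨ *-comm m (maxDegree F) ⟩
  maxDegree F * m                      ≤⟨ Δ*m≤n ⟩
  length F                             ≤⟨ m≤m+n (length F) _ ⟩
  2 * length F                         ∎
  where open ≤-Reasoning
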